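{- If $W$ is a conflict set for an NGBW $\mathcal{B}$, then $C_{\mathrm{NGBW}}(\mathcal{B})\geq|W|$.
   Context: An NGBW (nondeterministic generalized Büchi word automaton) is $(\Sigma,S,I,\Delta,\{F_1,\dots,F_k\})$ with finite alphabet, finite state set, $I\subseteq S$, $\Delta\subseteq S\times\Sigma\times S$ and $F_i\subseteq S$; a run over $\alpha\in\Sigma^\omega$ is $\rho(0)\rho(1)\cdots$ with $\rho(0)\in I$ and $\langle\rho(i),\alpha(i),\rho(i+1)\rangle\in\Delta$; it is successful if every $F_i$ contains a state occurring infinitely often in $\rho$; $\mathcal{L}(\mathcal{B})$ is the set of $\omega$-words with a successful run. $C_{\mathrm{NGBW}}(\mathcal{B})$ is the minimum number of states of an NGBW over $\Sigma$ accepting $\Sigma^\omega\setminus\mathcal{L}(\mathcal{B})$. A GC-segment of $\mathcal{B}$ is a nonempty finite word $w$ with $w^\omega\notin\mathcal{L}(\mathcal{B})$. Two GC-segments $w_1,w_2$ conflict if every $\omega$-word of the form $w_1^{k_0}(w_1^{k_1}w_2^{k_2})^\omega$ with integers $k_0,k_1,k_2>0$ is in $\mathcal{L}(\mathcal{B})$. A set $W$ of GC-segments of $\mathcal{B}$ is a conflict set if every two distinct elements $w_1\neq w_2$ of $W$ conflict. -}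

module Defs where

open import Data.Nat using (ℕ; zero; suc; _≤_; NonZero)
open import Data.Fin using (Fin)
open import Data.Bool using (Bool; true)
open import Data.List using (List; []; _∷_; length)
open import Data.List.NonEmpty using (List⁺; _∷_; _⁺++⁺_; toList)
open import Data.List.Membership.Propositional using (_∈_)
open import Data.Product using (Σ; ∃; _×_)
open import Relation.Binary.PropositionalEquality using (_≡_; _≢_)
open import Relation.Nullary using (¬_)

-- Alphabet: Fin m (a finite alphabet).  States: Fin n.
-- Subsets of finite sets are given by Bool-valued characteristic functions.
record NGBW (m n : ℕ) : Set where
  field
    init  : Fin n → Bool
    trans : Fin n → Fin m → Fin n → Bool
    k     : ℕ
    acc   : Fin k → Fin n → Bool

ωWord : Set → Set
ωWord A = ℕ → A

record Run {m n : ℕ} (B : NGBW m n) (α : ωWord (Fin m)) : Set where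
  field
    ρ     : ℕ → Fin n
    start : NGBW.init B (ρ 0) ≡ true
    step  : ∀ i → NGBW.trans B (ρ i) (α i) (ρ (suc i)) ≡ true

InfOften : {n : ℕ} → (ℕ → Fin n) → Fin n → Set
InfOften ρ q = ∀ N → ∃ λ t → N ≤ t × ρ t ≡ q

Successful : {m n : ℕ} {B : NGBW m n} {α : ωWord (Fin m)} → Run B α → Set
Successful {B = B} r =
  ∀ j → ∃ λ q → NGBW.acc B j q ≡ true × InfOften (Run.ρ r) q

Accepts : {m n : ℕ} → NGBW m n → ωWord (Fin m) → Set
Accepts B α = Σ (Run B α) Successful

cyc : {A : Set} → A → List A → List A → ℕ → A
cyc a as []      zero    = a
cyc a as []      (suc i) = cyc a as as i
cyc a as (x ∷ r) zero    = x
cyc a as (x ∷ r) (suc i) = cyc a as r i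

_^ω : {A : Set} → List⁺ A → ωWord A
(a ∷ as) ^ω = cyc a as []

_·_ : {A : Set} → List A → ωWord A → ωWord A
([] · β) i = β i
((x ∷ u) · β) zero = x
((x ∷ u) · β) (suc i) = (u · β) i

_^⁺_ : {A : Set} → List⁺ A → (k : ℕ) → {{NonZero k}} → List⁺ A
w ^⁺ suc zero = w
w ^⁺ suc (suc k) = w ⁺++⁺ (w ^⁺ suc k)

GCSegment : {m n : ℕ} → NGBW m n → List⁺ (Fin m) → Set
GCSegment B w = ¬ Accepts B (w ^ω)

Conflict : {m n : ℕ} → NGBW m n → List⁺ (Fin m) → List⁺ (Fin m) → Set
Conflict B w₁ w₂ =
  (k₀ k₁ k₂ : ℕ) → {{_ : NonZero k₀}} → {{_ : NonZero k₁}} → {{_ : NonZero k₂}} →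
  Accepts B (toList (w₁ ^⁺ k₀) · (((w₁ ^⁺ k₁) ⁺++⁺ (w₂ ^⁺ k₂)) ^ω))

-- W (a list without repetitions, representing a finite set) is a conflict set
ConflictSet : {m n : ℕ} → NGBW m n → List (List⁺ (Fin m)) → Set
ConflictSet B W =
  (∀ {w} → w ∈ W → GCSegment B w) ×
  (∀ {w₁ w₂} → w₁ ∈ W → w₂ ∈ W → w₁ ≢ w₂ → Conflict B w₁ w₂)

Complements : {m n n' : ℕ} → NGBW m n' → NGBW m n → Set
Complements B' B = ∀ α → (Accepts B' α → ¬ Accepts B α) × (¬ Accepts B α → Accepts B' α)

module Submission where

-- Let B' be an NGBW with n' states accepting the complement of
-- 𝓛(B).  Every GC-segment w of a conflict set W has w^ω ∉ 𝓛(B), so B' accepts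
-- w^ω.  By the pigeonhole principle an accepting run of B' on w^ω can be cut
-- at block boundaries (multiples of |w|) into a lasso: a stem labelled
-- w^(c+1) from an initial state to a state q, and a loop labelled w^(d+1) from
-- q back to q that meets every acceptance set.  Map w to this loop state q.
-- If two distinct w₁, w₂ ∈ W shared their loop state, then the stem of w₁
-- followed forever by the loop of w₁ and then the loop of w₂ would be an
-- accepting run of B' on w₁^(c₁+1) (w₁^(d₁+1) w₂^(d₂+1))^ω, a word that B
-- accepts because w₁ and w₂ conflict -- impossible.  Hence the map W → states
-- is injective and |W| ≤ n'.

open import Data.Bool using (true)
open import Data.Empty using (⊥-elim)
open import Data.Fin as Fin using (Fin; toℕ; _≟_)
open import Data.Fin.Properties using (pigeonhole; injective⇒≤)
open import Data.List using (List; []; _∷_; length; _++_; lookup)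
open import Data.List.Properties using (length-++)
open import Data.List.NonEmpty using (List⁺; _∷_; _⁺++⁺_; toList)
open import Data.List.Membership.Propositional.Properties using (∈-lookup)
open import Data.List.Relation.Unary.All as All using ()
open import Data.List.Relation.Unary.Any as Any using (Any; here; there)
open import Data.List.Relation.Unary.Any.Properties using (lookup-index; ++⁺ˡ)
open import Data.List.Relation.Unary.AllPairs using (_∷_)
open import Data.List.Relation.Unary.Unique.Propositional using (Unique)
open import Data.Nat using (ℕ; zero; suc; _+_; _*_; _∸_; _≤_; _<_; z≤n; s≤s; _≤′_; ≤′-refl; ≤′-step)
open import Data.Nat.Properties
  using ( +-identityʳ; +-assoc; +-comm; +-suc; *-distribʳ-+; *-monoˡ-≤; +-cancelʳ-<
        ; ≤-refl; ≤-trans; <-≤-trans; <⇒≤; n<1+n; ≤⇒≤′; m≤m+n; m≤n+m; m≤m*n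
        ; m∸n+n≡m; m≤n⇒∃[o]m+o≡n )
open import Data.Product using (∃; _×_; _,_; proj₁; proj₂)
open import Function.Definitions using (Injective)
open import Relation.Binary.PropositionalEquality
open import Relation.Nullary using (yes; no)

open import Defs

module _ {X : Set} where

  ·-right : (u : List X) (β : ωWord X) (i : ℕ) → (u · β) (length u + i) ≡ β i
  ·-right []      β i = refl
  ·-right (x ∷ u) β i = ·-right u β i

  ·-lookup : (u : List X) (β : ωWord X) (k : Fin (length u)) → (u · β) (toℕ k) ≡ lookup u k
  ·-lookup (x ∷ u) β Fin.zero    = refl
  ·-lookup (x ∷ u) β (Fin.suc k) = ·-lookup u β k

  ·-++ : (u v : List X) (β : ωWord X) → ((u ++ v) · β) ≗ (u · (v · β))
  ·-++ []      v β i       = refl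
  ·-++ (x ∷ u) v β zero    = refl
  ·-++ (x ∷ u) v β (suc i) = ·-++ u v β i

  ·-congʳ : (u : List X) {β γ : ωWord X} → β ≗ γ → (u · β) ≗ (u · γ)
  ·-congʳ []      e i       = e i
  ·-congʳ (x ∷ u) e zero    = refl
  ·-congʳ (x ∷ u) e (suc i) = ·-congʳ u e i

  -- The cycling function behind _^ω, started in the middle of a period.
  cyc-unfold : (a : X) (as r : List X) → cyc a as r ≗ (r · cyc a as [])
  cyc-unfold a as []      i       = refl
  cyc-unfold a as (x ∷ r) zero    = refl
  cyc-unfold a as (x ∷ r) (suc i) = cyc-unfold a as r i

  ω-unfold : (w : List⁺ X) → (w ^ω) ≗ (toList w · (w ^ω))
  ω-unfold (a ∷ as) zero    = refl
  ω-unfold (a ∷ as) (suc i) = cyc-unfold a as as i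

  ω-periodic : (w : List⁺ X) (c i : ℕ) → (w ^ω) (c * length (toList w) + i) ≡ (w ^ω) i
  ω-periodic w zero    i = refl
  ω-periodic w (suc c) i = begin
    (w ^ω) ((ℓ + c * ℓ) + i)             ≡⟨ cong (w ^ω) (+-assoc ℓ (c * ℓ) i) ⟩
    (w ^ω) (ℓ + (c * ℓ + i))             ≡⟨ ω-unfold w (ℓ + (c * ℓ + i)) ⟩
    (toList w · (w ^ω)) (ℓ + (c * ℓ + i)) ≡⟨ ·-right (toList w) (w ^ω) (c * ℓ + i) ⟩
    (w ^ω) (c * ℓ + i)                   ≡⟨ ω-periodic w c i ⟩
    (w ^ω) i                             ∎
    where
    open ≡-Reasoning
    ℓ = length (toList w)

  ω-recurrent : (s : List X) (σ : List⁺ X) (k : Fin (length (toList σ))) (N : ℕ) →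
                ∃ λ t → N ≤ t × (s · (σ ^ω)) t ≡ lookup (toList σ) k
  ω-recurrent s σ k N = length s + (N * ℓ + toℕ k) , N≤t , (begin
    (s · (σ ^ω)) (length s + (N * ℓ + toℕ k)) ≡⟨ ·-right s (σ ^ω) (N * ℓ + toℕ k) ⟩
    (σ ^ω) (N * ℓ + toℕ k)                   ≡⟨ ω-periodic σ N (toℕ k) ⟩
    (σ ^ω) (toℕ k)                           ≡⟨ ω-unfold σ (toℕ k) ⟩
    (toList σ · (σ ^ω)) (toℕ k)               ≡⟨ ·-lookup (toList σ) (σ ^ω) k ⟩
    lookup (toList σ) k                      ∎)
    where
    open ≡-Reasoning
    ℓ = length (toList σ)
    N≤t : N ≤ length s + (N * ℓ + toℕ k)
    N≤t = ≤-trans (m≤m*n N ℓ) (≤-trans (m≤m+n (N * ℓ) (toℕ k)) (m≤n+m _ (length s)))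

  length-^⁺ : (w : List⁺ X) (k : ℕ) → length (toList (w ^⁺ suc k)) ≡ suc k * length (toList w)
  length-^⁺ w zero    = sym (+-identityʳ _)
  length-^⁺ w (suc k) = trans (length-++ (toList w)) (cong (length (toList w) +_) (length-^⁺ w k))

  ^⁺-unfold : (w : List⁺ X) (k : ℕ) → (w ^ω) ≗ (toList (w ^⁺ suc k) · (w ^ω))
  ^⁺-unfold w zero    = ω-unfold w
  ^⁺-unfold w (suc k) i = begin
    (w ^ω) i                                          ≡⟨ ω-unfold w i ⟩
    (toList w · (w ^ω)) i                              ≡⟨ ·-congʳ (toList w) (^⁺-unfold w k) i ⟩
    (toList w · (toList (w ^⁺ suc k) · (w ^ω))) i      ≡⟨ sym (·-++ (toList w) (toList (w ^⁺ suc k)) (w ^ω) i) ⟩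
    (toList (w ^⁺ suc (suc k)) · (w ^ω)) i             ∎
    where open ≡-Reasoning

bounded : ∀ {k} (f : Fin k → ℕ) → ∃ λ M → ∀ j → f j ≤ M
bounded {zero}  f = 0 , λ ()
bounded {suc k} f with bounded (λ j → f (Fin.suc j))
... | M , le = f Fin.zero + M , λ where
  Fin.zero    → m≤m+n (f Fin.zero) M
  (Fin.suc j) → ≤-trans (le j) (m≤n+m M (f Fin.zero))

gap : ∀ {a b} → a < b → ∃ λ d → a + suc d ≡ b
gap {a} a<b with m≤n⇒∃[o]m+o≡n a<b
... | d , e = d , trans (+-suc a d) e

module Paths {m n : ℕ} (A : NGBW m n) where

  Step : (ℕ → Fin n) → ωWord (Fin m) → ℕ → Set
  Step ρ α i = NGBW.trans A (ρ i) (α i) (ρ (suc i)) ≡ true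

  IsRun : (ℕ → Fin n) → ωWord (Fin m) → Set
  IsRun ρ α = ∀ i → Step ρ α i

  step-cong : {ρ ρ' : ℕ → Fin n} {α α' : ωWord (Fin m)} → ρ ≗ ρ' → α ≗ α' →
              ∀ i → Step ρ α i → Step ρ' α' i
  step-cong {ρ} {ρ'} {α} eρ eα i s =
    subst₂ (λ p a → NGBW.trans A p a (ρ' (suc i)) ≡ true) (eρ i) (eα i)
      (subst (λ r → NGBW.trans A (ρ i) (α i) r ≡ true) (eρ (suc i)) s)

  data Path : Fin n → List (Fin m) → Fin n → Set where
    []  : ∀ {p} → Path p [] p
    _∷_ : ∀ {p a q r u} → NGBW.trans A p a q ≡ true → Path q u r → Path p (a ∷ u) r

  -- The states a path leaves, one per letter (the final state is excluded).
  sources : ∀ {p u q} → Path p u q → List (Fin n)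
  sources []             = []
  sources (_∷_ {p} _ π) = p ∷ sources π

  sources⁺ : ∀ {p a u q} → Path p (a ∷ u) q → List⁺ (Fin n)
  sources⁺ (_∷_ {p} _ π) = p ∷ sources π

  Visits : ∀ {p u q} → Path p u q → Set
  Visits π = ∀ j → Any (λ s → NGBW.acc A j s ≡ true) (sources π)

  _++ᵖ_ : ∀ {p u q v r} → Path p u q → Path q v r → Path p (u ++ v) r
  []      ++ᵖ π' = π'
  (t ∷ π) ++ᵖ π' = t ∷ (π ++ᵖ π')

  sources-++ : ∀ {p u q v r} (π : Path p u q) (π' : Path q v r) →
               sources (π ++ᵖ π') ≡ sources π ++ sources π'
  sources-++ []      π' = refl
  sources-++ (t ∷ π) π' = cong (_ ∷_) (sources-++ π π')

  visits-++ˡ : ∀ {p u q v r} (π : Path p u q) (π' : Path q v r) → Visits π → Visits (π ++ᵖ π')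
  visits-++ˡ π π' vis j = subst (Any _) (sym (sources-++ π π')) (++⁺ˡ (vis j))

  recast : ∀ {p p' u q q'} → p ≡ p' → q ≡ q' → Path p u q → Path p' u q'
  recast refl refl π = π

  visits-recast : ∀ {p p' u q q'} (e : p ≡ p') (e' : q ≡ q') (π : Path p u q) →
                  Visits π → Visits (recast e e' π)
  visits-recast refl refl π vis = vis

  follow-start : ∀ {p u q} (π : Path p u q) {ρ : ℕ → Fin n} → ρ 0 ≡ q → (sources π · ρ) 0 ≡ p
  follow-start []      e = e
  follow-start (t ∷ π) e = refl

  follow : ∀ {p u q} (π : Path p u q) {ρ : ℕ → Fin n} {β : ωWord (Fin m)} → ρ 0 ≡ q →
           (N : ℕ) → (∀ i → i < N → Step ρ β i) →
           ∀ i → i < length u + N → Step (sources π · ρ) (u · β) i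
  follow []      e N steps i       lt       = steps i lt
  follow (t ∷ π) e N steps zero    lt       =
    subst (λ r → NGBW.trans A _ _ r ≡ true) (sym (follow-start π e)) t
  follow (t ∷ π) e N steps (suc i) (s≤s lt) = follow π e N steps i lt

  prefix-run : ∀ {p u q} (π : Path p u q) {ρ : ℕ → Fin n} {β : ωWord (Fin m)} → ρ 0 ≡ q →
               IsRun ρ β → IsRun (sources π · ρ) (u · β)
  prefix-run {u = u} π e run i = follow π e (suc i) (λ k _ → run k) i (m≤n+m (suc i) (length u))

  cycle-run : ∀ {q} (v : List⁺ (Fin m)) (loop : Path q (toList v) q) →
              IsRun (sources⁺ loop ^ω) (v ^ω)
  cycle-run v (t ∷ π) i = steps-below (suc i) i ≤-refl
    where
    σ = sources⁺ (t ∷ π)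
    -- each lap around the loop extends the valid prefix by |v| ≥ 1 steps
    steps-below : ∀ N i → i < N → Step (σ ^ω) (v ^ω) i
    steps-below (suc N) i lt =
      step-cong (λ x → sym (ω-unfold σ x)) (λ x → sym (ω-unfold v x)) i
        (follow (t ∷ π) refl N (steps-below N) i
          (≤-trans lt (s≤s (m≤n+m N (length (List⁺.tail v))))))

  lasso-accepts : ∀ {p u q} → NGBW.init A p ≡ true → (π : Path p u q) →
                  (v : List⁺ (Fin m)) (loop : Path q (toList v) q) → Visits loop →
                  Accepts A (u · (v ^ω))
  lasso-accepts ip π v (t ∷ π') vis = run , successful
    where
    σ = sources⁺ (t ∷ π')
    run : Run A _
    run = record
      { ρ     = sources π · (σ ^ω)
      ; start = subst (λ s → NGBW.init A s ≡ true) (sym (follow-start π refl)) ip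
      ; step  = prefix-run π refl (cycle-run v (t ∷ π'))
      }
    successful : Successful run
    successful j = lookup (toList σ) k , lookup-index (vis j) , ω-recurrent (sources π) σ k
      where k = Any.index (vis j)

  cut : (u : List (Fin m)) {ρ : ℕ → Fin n} {β : ωWord (Fin m)} →
        IsRun ρ (u · β) → Path (ρ 0) u (ρ (length u))
  cut []      run = []
  cut (a ∷ u) run = run 0 ∷ cut u (λ i → run (suc i))

  cut-sources : (u : List (Fin m)) {ρ : ℕ → Fin n} {β : ωWord (Fin m)} (run : IsRun ρ (u · β))
                {P : Fin n → Set} {i : ℕ} → i < length u → P (ρ i) → Any P (sources (cut u run))
  cut-sources (a ∷ u) run {i = zero}  lt       pi = here pi
  cut-sources (a ∷ u) run {i = suc i} (s≤s lt) pi = there (cut-sources u (λ i → run (suc i)) lt pi)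

-- The lasso inside an accepting run on an ω-power w^ω, with stem and loop
-- cut at block boundaries, so that both are labelled by powers of w.

module OmegaPowerLassos {m n : ℕ} (A : NGBW m n) (w : List⁺ (Fin m)) where
  open Paths A

  ℓ : ℕ
  ℓ = length (toList w)

  record Lasso : Set where
    field
      {start loop-state} : Fin n
      c d     : ℕ
      initial : NGBW.init A start ≡ true
      stem    : Path start (toList (w ^⁺ suc c)) loop-state
      loop    : Path loop-state (toList (w ^⁺ suc d)) loop-state
      visits  : Visits loop

  module _ (r : Run A (w ^ω)) (accepting : Successful r) where
    open Run r using (ρ)

    MeetsAllBetween : ℕ → ℕ → Set
    MeetsAllBetween a b = ∀ j → ∃ λ t → a * ℓ ≤ t × t < b * ℓ × NGBW.acc A j (ρ t) ≡ true

    meets-mono : ∀ {a b b'} → MeetsAllBetween a b → b ≤ b' → MeetsAllBetween a b'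
    meets-mono meets b≤b' j with meets j
    ... | t , a≤t , t<b , acc = t , a≤t , <-≤-trans t<b (*-monoˡ-≤ ℓ b≤b') , acc

    -- Since each acceptance set is met infinitely often, every block starts a
    -- finite window meeting all of them.
    window : ∀ a → ∃ λ b → a < b × MeetsAllBetween a b
    window a = suc (a + M) , s≤s (m≤m+n a M) , meets
      where
      visit : ∀ j → ∃ λ t → a * ℓ ≤ t × ρ t ≡ proj₁ (accepting j)
      visit j = proj₂ (proj₂ (accepting j)) (a * ℓ)
      M = proj₁ (bounded (λ j → proj₁ (visit j)))
      meets : MeetsAllBetween a (suc (a + M))
      meets j with visit j | proj₂ (bounded (λ j → proj₁ (visit j))) j
      ... | t , a≤t , ρt≡q | t≤M =
        t , a≤t ,
        ≤-trans (s≤s (≤-trans t≤M (m≤n+m M a))) (m≤m*n (suc (a + M)) ℓ) ,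
        trans (cong (NGBW.acc A j) ρt≡q) (proj₁ (proj₂ (accepting j)))

    -- Block boundaries 1 = b₀ < b₁ < … with all acceptance sets met between
    -- consecutive ones.
    checkpoint : ℕ → ℕ
    checkpoint zero    = 1
    checkpoint (suc i) = proj₁ (window (checkpoint i))

    checkpoint-step : ∀ i → checkpoint i < checkpoint (suc i)
    checkpoint-step i = proj₁ (proj₂ (window (checkpoint i)))

    checkpoint-meets : ∀ i → MeetsAllBetween (checkpoint i) (checkpoint (suc i))
    checkpoint-meets i = proj₂ (proj₂ (window (checkpoint i)))

    checkpoint-mono : ∀ {i j} → i ≤′ j → checkpoint i ≤ checkpoint j
    checkpoint-mono ≤′-refl       = ≤-refl
    checkpoint-mono (≤′-step i≤j) = ≤-trans (checkpoint-mono i≤j) (<⇒≤ (checkpoint-step _))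

    shifted-run : (t k : ℕ) → IsRun (λ i → ρ (i + t * ℓ)) (toList (w ^⁺ suc k) · (w ^ω))
    shifted-run t k i =
      step-cong {ρ = λ x → ρ (x + t * ℓ)} (λ _ → refl) word i (Run.step r (i + t * ℓ))
      where
      word : (λ x → (w ^ω) (x + t * ℓ)) ≗ (toList (w ^⁺ suc k) · (w ^ω))
      word x = trans (cong (w ^ω) (+-comm x (t * ℓ)))
                 (trans (ω-periodic w t x) (^⁺-unfold w k x))

    block-end : (t k : ℕ) → length (toList (w ^⁺ suc k)) + t * ℓ ≡ (t + suc k) * ℓ
    block-end t k = trans (cong (_+ t * ℓ) (length-^⁺ w k))
      (trans (+-comm (suc k * ℓ) (t * ℓ)) (sym (*-distribʳ-+ ℓ t (suc k))))

    block : (t k : ℕ) → Path (ρ (t * ℓ)) (toList (w ^⁺ suc k)) (ρ ((t + suc k) * ℓ))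
    block t k = recast refl (cong ρ (block-end t k)) (cut (toList (w ^⁺ suc k)) (shifted-run t k))

    block-visits : ∀ t k → MeetsAllBetween t (t + suc k) → Visits (block t k)
    block-visits t k meets =
      visits-recast refl (cong ρ (block-end t k)) (cut u (shifted-run t k)) met
      where
      u = toList (w ^⁺ suc k)
      met : Visits (cut u (shifted-run t k))
      met j with meets j
      ... | s , t≤s , s<end , acc =
        cut-sources u (shifted-run t k) i<|u| (subst (λ x → NGBW.acc A j (ρ x) ≡ true) (sym i+tℓ≡s) acc)
        where
        i = s ∸ t * ℓ
        i+tℓ≡s : i + t * ℓ ≡ s
        i+tℓ≡s = m∸n+n≡m t≤s
        i<|u| : i < length u
        i<|u| = +-cancelʳ-< (t * ℓ) i (length u) (subst₂ _<_ (sym i+tℓ≡s) (sym (block-end t k)) s<end)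

    lasso-between : ∀ {a b} → 0 < a → a < b → MeetsAllBetween a b → ρ (a * ℓ) ≡ ρ (b * ℓ) → Lasso
    lasso-between {a} {b} 0<a a<b meets same with gap 0<a | gap a<b
    ... | c , 1+c≡a | d , a+1+d≡b = record
      { c       = c
      ; d       = d
      ; initial = Run.start r
      ; stem    = recast refl (cong (λ x → ρ (x * ℓ)) 1+c≡a) (block 0 c)
      ; loop    = recast refl loop-closes (block a d)
      ; visits  = visits-recast refl loop-closes (block a d)
                    (block-visits a d (subst (MeetsAllBetween a) (sym a+1+d≡b) meets))
      }
      where
      loop-closes : ρ ((a + suc d) * ℓ) ≡ ρ (a * ℓ)
      loop-closes = trans (cong (λ x → ρ (x * ℓ)) a+1+d≡b) (sym same)

    -- Among the n + 1 checkpoints b₀ < … < bₙ two carry the same state.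
    lasso : Lasso
    lasso with pigeonhole (n<1+n n) (λ i → ρ (checkpoint (toℕ i) * ℓ))
    ... | i , j , i<j , same =
      lasso-between {checkpoint (toℕ i)} (checkpoint-mono (≤⇒≤′ z≤n))
        (<-≤-trans (checkpoint-step (toℕ i)) later)
        (meets-mono {checkpoint (toℕ i)} (checkpoint-meets (toℕ i)) later) same
      where
      later : checkpoint (suc (toℕ i)) ≤ checkpoint (toℕ j)
      later = checkpoint-mono (≤⇒≤′ i<j)

open OmegaPowerLassos using (Lasso)

lasso-of-accepted : ∀ {m n} (A : NGBW m n) (w : List⁺ (Fin m)) → Accepts A (w ^ω) → Lasso A w
lasso-of-accepted A w (r , accepting) = OmegaPowerLassos.lasso A w r accepting

lookup-injective : ∀ {X : Set} {xs : List X} → Unique xs →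
                   ∀ {i j} → lookup xs i ≡ lookup xs j → i ≡ j
lookup-injective (_ ∷ _)      {Fin.zero}  {Fin.zero}  _ = refl
lookup-injective (x∉xs ∷ _)   {Fin.zero}  {Fin.suc j} e = ⊥-elim (All.lookup x∉xs (∈-lookup j) e)
lookup-injective (x∉xs ∷ _)   {Fin.suc i} {Fin.zero}  e = ⊥-elim (All.lookup x∉xs (∈-lookup i) (sym e))
lookup-injective (_ ∷ unique) {Fin.suc i} {Fin.suc j} e = cong Fin.suc (lookup-injective unique e)

-- Conflicting GC-segments cannot share a loop state in a complement
-- automaton: gluing the loops would make it accept a word that B accepts.
loop-states-differ : ∀ {m n n'} {B : NGBW m n} {B' : NGBW m n'} → Complements B' B →
                     ∀ {w₁ w₂} → Conflict B w₁ w₂ → (L₁ : Lasso B' w₁) (L₂ : Lasso B' w₂) →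
                     Lasso.loop-state L₁ ≢ Lasso.loop-state L₂
loop-states-differ {B' = B'} complement {w₁} {w₂} conflict L₁ L₂ same =
  proj₁ (complement _) glued (conflict (suc (c L₁)) (suc (d L₁)) (suc (d L₂)))
  where
  open Lasso
  open Paths B'
  glued : Accepts B' (toList (w₁ ^⁺ suc (c L₁)) · (((w₁ ^⁺ suc (d L₁)) ⁺++⁺ (w₂ ^⁺ suc (d L₂))) ^ω))
  glued = lasso-accepts (initial L₁) (stem L₁) ((w₁ ^⁺ suc (d L₁)) ⁺++⁺ (w₂ ^⁺ suc (d L₂)))
            (loop L₁ ++ᵖ recast (sym same) (sym same) (loop L₂))
            (visits-++ˡ (loop L₁) _ (visits L₁))

lemma5p3 : {m n : ℕ} (B : NGBW m n) (W : List (List⁺ (Fin m))) →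
    Unique W → ConflictSet B W →
    (n' : ℕ) (B' : NGBW m n') → Complements B' B → length W ≤ n'
lemma5p3 B W unique (segments , conflicts) n' B' complement = injective⇒≤ loop-state-injective
  where
  lasso-at : (i : Fin (length W)) → Lasso B' (lookup W i)
  lasso-at i = lasso-of-accepted B' _ (proj₂ (complement _) (segments (∈-lookup i)))

  loop-state-injective : Injective _≡_ _≡_ (λ i → Lasso.loop-state (lasso-at i))
  loop-state-injective {i} {j} same with i ≟ j
  ... | yes i≡j = i≡j
  ... | no i≢j  = ⊥-elim (loop-states-differ complement
                    (conflicts (∈-lookup i) (∈-lookup j) (λ e → i≢j (lookup-injective unique e)))
                    (lasso-at i) (lasso-at j) same)
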